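{- Let $\mathbf L=(L,\vee,\wedge,{}^*,0,1)$ be a Stone lattice and $A$ a deductive system of the second kind of $\mathbf L$. Define the binary relation $\Theta(A)$ on $L$ by $(x,y)\in\Theta(A)$ iff $x\Rightarrow y\in A$ and $y\Rightarrow x\in A$. Then: (i) $\Theta(A)$ is reflexive, symmetric and compatible with all fundamental operations $\vee,\wedge,{}^*,0,1$ of $\mathbf L$, and $[1]\big(\Theta(A)\big)=\{x\in L\mid x^{**}\in A\}$, where $[1]\big(\Theta(A)\big)=\{x\in L\mid (x,1)\in\Theta(A)\}$; (ii) if $A$ is closed with respect to $\wedge$, then $\Theta(A)$ is a congruence of $\mathbf L$.
   Context: A bounded lattice is pseudocomplemented if for each $a$ there is a greatest element $a^*$ with $a\wedge a^*=0$. A Stone lattice is a distributive pseudocomplemented lattice satisfying $x^*\vee x^{**}=1$ for all $x$. Define $x\Rightarrow y:=x^*\vee y^{**}$. A deductive system of the second kind of $\mathbf L$ is a subset $A\subseteq L$ with $1\in A$ such that $x\in A$, $y\in L$ and $x\Rightarrow y\in A$ imply $y\in A$. A congruence of $\mathbf L$ is an equivalence relation on $L$ compatible with $\vee,\wedge,{}^*$. -}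

module Defs where

open import Level using (Level; suc; _⊔_)
open import Data.Product using (_×_)
open import Relation.Binary.Core using (Rel)
open import Relation.Binary.Definitions using (Reflexive; Symmetric; Transitive; _Respects_)
open import Algebra.Core using (Op₁; Op₂)
open import Algebra.Lattice.Structures using (IsDistributiveLattice)

record StoneLattice (c ℓ : Level) : Set (suc (c ⊔ ℓ)) where
  infixr 7 _∧_
  infixr 6 _∨_
  infix 4 _≈_ _≤_
  field
    Carrier : Set c
    _≈_     : Rel Carrier ℓ
    _∨_     : Op₂ Carrier
    _∧_     : Op₂ Carrier
    _*      : Op₁ Carrier
    𝟘       : Carrier
    𝟙       : Carrier
    isDistributiveLattice : IsDistributiveLattice _≈_ _∨_ _∧_
    𝟘-least    : ∀ x → 𝟘 ∧ x ≈ 𝟘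
    𝟙-greatest : ∀ x → 𝟙 ∧ x ≈ x
  _≤_ : Rel Carrier ℓ
  x ≤ y = x ∧ y ≈ x
  field
    *-disjoint : ∀ a → a ∧ (a *) ≈ 𝟘
    *-greatest : ∀ a x → a ∧ x ≈ 𝟘 → x ≤ a *
    stone      : ∀ x → (x *) ∨ ((x *) *) ≈ 𝟙

  open IsDistributiveLattice isDistributiveLattice public

module _ {c ℓ : Level} (L : StoneLattice c ℓ) where
  open StoneLattice L

  _⇒_ : Op₂ Carrier
  x ⇒ y = (x *) ∨ ((y *) *)

  record IsDeductiveSystem₂ {p : Level} (A : Carrier → Set p) : Set (c ⊔ ℓ ⊔ p) where
    field
      respects : A Respects _≈_
      has-𝟙    : A 𝟙
      mp       : ∀ x y → A x → A (x ⇒ y) → A y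

  Θ : {p : Level} → (Carrier → Set p) → Rel Carrier p
  Θ A x y = A (x ⇒ y) × A (y ⇒ x)

  record IsCompatible {r : Level} (R : Rel Carrier r) : Set (c ⊔ r) where
    field
      ∨-compat : ∀ {x y u v} → R x y → R u v → R (x ∨ u) (y ∨ v)
      ∧-compat : ∀ {x y u v} → R x y → R u v → R (x ∧ u) (y ∧ v)
      *-compat : ∀ {x y} → R x y → R (x *) (y *)
      𝟘-compat : R 𝟘 𝟘
      𝟙-compat : R 𝟙 𝟙

  record IsCongruence {r : Level} (R : Rel Carrier r) : Set (c ⊔ r) where
    field
      refl′     : Reflexive R
      sym′      : Symmetric R
      trans′    : Transitive R
      ∨-compat : ∀ {x y u v} → R x y → R u v → R (x ∨ u) (y ∨ v)
      ∧-compat : ∀ {x y u v} → R x y → R u v → R (x ∧ u) (y ∧ v)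
      *-compat : ∀ {x y} → R x y → R (x *) (y *)

-- In a Stone lattice the implication x ⇒ y = x* ∨ y** is residuated up to
-- double pseudocomplement: t ∧ x ≤ y** gives t ≤ x ⇒ y, and x** ∧ (x ⇒ y) ≤ y**.
-- Hence x ≤ y forces 1 ≤ x ⇒ y, so a deductive system of the second kind is
-- upward closed, and it is closed under ∧ because x ≤ y ⇒ (x ∧ y); it is a
-- lattice filter. Transitivity and compatibility of Θ(A) then reduce to lattice
-- inequalities such as (x ⇒ y) ∧ (y ⇒ z) ≤ x ⇒ z, all obtained from the two
-- residuation laws.
module Submission where

open import Defs using (StoneLattice; IsDeductiveSystem₂; Θ; IsCompatible; IsCongruence)
import Defs
open import Level using (Level)
open import Data.Product using (_×_; _,_)
open import Function.Bundles using (_⇔_; mk⇔)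
open import Relation.Binary.Bundles using (Poset)
open import Relation.Binary.Definitions using (Reflexive; Symmetric; Transitive; _Respects_)
open import Algebra.Core using (Op₂)
open import Algebra.Bundles using (CommutativeSemigroup)
open import Algebra.Lattice.Bundles using (Lattice)
import Algebra.Lattice.Properties.Lattice as LatticeProperties
import Algebra.Properties.CommutativeSemigroup as CommutativeSemigroupProperties
import Relation.Binary.Lattice as OrderLattice
import Relation.Binary.Lattice.Properties.JoinSemilattice as JoinSemilatticeProperties
import Relation.Binary.Lattice.Properties.MeetSemilattice as MeetSemilatticeProperties
import Relation.Binary.Reasoning.PartialOrder as PartialOrderReasoning

module StoneLatticeProperties {c ℓ : Level} (L : StoneLattice c ℓ) where
  open StoneLattice L hiding (_≤_)

  lattice : Lattice c ℓ
  lattice = record { isLattice = isLattice }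

  open LatticeProperties lattice using (poset; ∧-isSemigroup; ∨-∧-orderTheoreticLattice)
  -- The library's order x ≈ x ∧ y; StoneLattice's own _≤_ is its symmetric variant.
  open Poset poset public using (_≤_)
    renaming (refl to ≤-refl; reflexive to ≤-reflexive; trans to ≤-trans; antisym to ≤-antisym)
  open OrderLattice.Lattice ∨-∧-orderTheoreticLattice
    using (x≤x∨y; y≤x∨y; ∨-least; x∧y≤x; x∧y≤y; ∧-greatest; joinSemilattice; meetSemilattice)
  open JoinSemilatticeProperties joinSemilattice using (∨-monotonic; x≤y⇒x∨y≈y)
  open MeetSemilatticeProperties meetSemilattice using (∧-monotonic)
  open PartialOrderReasoning poset

  ∧-commutativeSemigroup : CommutativeSemigroup c ℓ
  ∧-commutativeSemigroup =
    record { isCommutativeSemigroup = record { isSemigroup = ∧-isSemigroup ; comm = ∧-comm } }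

  open CommutativeSemigroupProperties ∧-commutativeSemigroup using (x∙yz≈zx∙y)

  infix 5 _⇒_
  _⇒_ : Op₂ Carrier
  _⇒_ = Defs._⇒_ L

  ∧-identityʳ : ∀ x → x ∧ 𝟙 ≈ x
  ∧-identityʳ x = trans (∧-comm x 𝟙) (𝟙-greatest x)

  𝟘≤ : ∀ x → 𝟘 ≤ x
  𝟘≤ x = sym (𝟘-least x)

  ≤𝟙 : ∀ x → x ≤ 𝟙
  ≤𝟙 x = sym (∧-identityʳ x)

  ∧≤𝟘⇒≤* : ∀ {x y} → x ∧ y ≤ 𝟘 → y ≤ x *
  ∧≤𝟘⇒≤* {x} {y} x∧y≤𝟘 = sym (*-greatest x y (≤-antisym x∧y≤𝟘 (𝟘≤ (x ∧ y))))

  x∧x*≤𝟘 : ∀ x → x ∧ x * ≤ 𝟘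
  x∧x*≤𝟘 x = ≤-reflexive (*-disjoint x)

  x*∧x≤𝟘 : ∀ x → x * ∧ x ≤ 𝟘
  x*∧x≤𝟘 x = ≤-trans (≤-reflexive (∧-comm (x *) x)) (x∧x*≤𝟘 x)

  x≤x** : ∀ x → x ≤ x * *
  x≤x** x = ∧≤𝟘⇒≤* (x*∧x≤𝟘 x)

  *-antitone : ∀ {x y} → x ≤ y → y * ≤ x *
  *-antitone {x} {y} x≤y = ∧≤𝟘⇒≤* (≤-trans (∧-monotonic x≤y ≤-refl) (x∧x*≤𝟘 y))

  **-monotone : ∀ {x y} → x ≤ y → x * * ≤ y * *
  **-monotone x≤y = *-antitone (*-antitone x≤y)

  **-cong : ∀ {x y} → x ≈ y → x * * ≈ y * *
  **-cong x≈y = ≤-antisym (**-monotone (≤-reflexive x≈y)) (**-monotone (≤-reflexive (sym x≈y)))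

  ****≤** : ∀ x → x * * * * ≤ x * *
  ****≤** x = *-antitone (x≤x** (x *))

  𝟙*≈𝟘 : 𝟙 * ≈ 𝟘
  𝟙*≈𝟘 = trans (sym (𝟙-greatest (𝟙 *))) (*-disjoint 𝟙)

  *∧-≤ : ∀ x y → (x ∧ y) * ∧ x ≤ y *
  *∧-≤ x y = ∧≤𝟘⇒≤* (begin
    y ∧ ((x ∧ y) * ∧ x)  ≈⟨ x∙yz≈zx∙y y ((x ∧ y) *) x ⟩
    (x ∧ y) ∧ (x ∧ y) *  ≤⟨ x∧x*≤𝟘 (x ∧ y) ⟩
    𝟘                    ∎)

  ∧-**-≤ : ∀ x y → x ∧ y * * ≤ (x ∧ y) * *
  ∧-**-≤ x y = ∧≤𝟘⇒≤* (begin
    (x ∧ y) * ∧ (x ∧ y * *)  ≈⟨ sym (∧-assoc ((x ∧ y) *) x (y * *)) ⟩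
    ((x ∧ y) * ∧ x) ∧ y * *  ≤⟨ ∧-monotonic (*∧-≤ x y) ≤-refl ⟩
    y * ∧ y * *              ≤⟨ x∧x*≤𝟘 (y *) ⟩
    𝟘                        ∎)

  **-∧ : ∀ x y → x * * ∧ y * * ≤ (x ∧ y) * *
  **-∧ x y = begin
    x * * ∧ y * *        ≤⟨ ∧-**-≤ (x * *) y ⟩
    (x * * ∧ y) * *      ≈⟨ **-cong (∧-comm (x * *) y) ⟩
    (y ∧ x * *) * *      ≤⟨ **-monotone (∧-**-≤ y x) ⟩
    (y ∧ x) * * * *      ≤⟨ ****≤** (y ∧ x) ⟩
    (y ∧ x) * *          ≈⟨ **-cong (∧-comm y x) ⟩
    (x ∧ y) * *          ∎

  ⇒-intro : ∀ {t x y} → t ∧ x ≤ y * * → t ≤ x ⇒ y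
  ⇒-intro {t} {x} {y} t∧x≤y** = begin
    t                        ≈⟨ sym (∧-identityʳ t) ⟩
    t ∧ 𝟙                    ≈⟨ ∧-congˡ (sym (stone x)) ⟩
    t ∧ (x * ∨ x * *)        ≈⟨ ∧-distribˡ-∨ t (x *) (x * *) ⟩
    t ∧ x * ∨ t ∧ x * *      ≤⟨ ∨-monotonic (x∧y≤y t (x *)) (∧-**-≤ t x) ⟩
    x * ∨ (t ∧ x) * *        ≤⟨ ∨-monotonic ≤-refl (**-monotone t∧x≤y**) ⟩
    x * ∨ y * * * *          ≤⟨ ∨-monotonic ≤-refl (****≤** y) ⟩
    x ⇒ y                    ∎

  ⇒-elim : ∀ {t x y} → t ≤ x * * → t ≤ x ⇒ y → t ≤ y * *
  ⇒-elim {t} {x} {y} t≤x** t≤x⇒y = begin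
    t                                ≤⟨ ∧-greatest t≤x** t≤x⇒y ⟩
    x * * ∧ (x * ∨ y * *)            ≈⟨ ∧-distribˡ-∨ (x * *) (x *) (y * *) ⟩
    x * * ∧ x * ∨ x * * ∧ y * *      ≤⟨ ∨-least (≤-trans (x*∧x≤𝟘 (x *)) (𝟘≤ (y * *))) (x∧y≤y (x * *) (y * *)) ⟩
    y * *                            ∎

  ≤⇒𝟙≤⇒ : ∀ {x y} → x ≤ y → 𝟙 ≤ x ⇒ y
  ≤⇒𝟙≤⇒ {x} {y} x≤y = ⇒-intro (≤-trans (x∧y≤y 𝟙 x) (≤-trans x≤y (x≤x** y)))

  𝟙⇒x≈x** : ∀ x → 𝟙 ⇒ x ≈ x * *
  𝟙⇒x≈x** x = trans (∨-congʳ 𝟙*≈𝟘) (x≤y⇒x∨y≈y (𝟘≤ (x * *)))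

  ⇒-trans : ∀ x y z → (x ⇒ y) ∧ (y ⇒ z) ≤ x ⇒ z
  ⇒-trans x y z = ⇒-intro (⇒-elim t∧x≤y** (≤-trans (x∧y≤x t x) (x∧y≤y (x ⇒ y) (y ⇒ z))))
    where
    t : Carrier
    t = (x ⇒ y) ∧ (y ⇒ z)
    t∧x≤y** : t ∧ x ≤ y * *
    t∧x≤y** = ⇒-elim (≤-trans (x∧y≤y t x) (x≤x** x)) (≤-trans (x∧y≤x t x) (x∧y≤x (x ⇒ y) (y ⇒ z)))

  ⇒-∨ : ∀ x y u v → (x ⇒ y) ∧ (u ⇒ v) ≤ (x ∨ u) ⇒ (y ∨ v)
  ⇒-∨ x y u v = ⇒-intro (begin
    t ∧ (x ∨ u)      ≈⟨ ∧-distribˡ-∨ t x u ⟩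
    t ∧ x ∨ t ∧ u    ≤⟨ ∨-monotonic t∧x≤y** t∧u≤v** ⟩
    y * * ∨ v * *    ≤⟨ ∨-least (**-monotone (x≤x∨y y v)) (**-monotone (y≤x∨y y v)) ⟩
    (y ∨ v) * *      ∎)
    where
    t : Carrier
    t = (x ⇒ y) ∧ (u ⇒ v)
    t∧x≤y** : t ∧ x ≤ y * *
    t∧x≤y** = ⇒-elim (≤-trans (x∧y≤y t x) (x≤x** x)) (≤-trans (x∧y≤x t x) (x∧y≤x (x ⇒ y) (u ⇒ v)))
    t∧u≤v** : t ∧ u ≤ v * *
    t∧u≤v** = ⇒-elim (≤-trans (x∧y≤y t u) (x≤x** u)) (≤-trans (x∧y≤x t u) (x∧y≤y (x ⇒ y) (u ⇒ v)))

  ⇒-∧ : ∀ x y u v → (x ⇒ y) ∧ (u ⇒ v) ≤ (x ∧ u) ⇒ (y ∧ v)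
  ⇒-∧ x y u v = ⇒-intro (begin
    t ∧ (x ∧ u)      ≤⟨ ∧-greatest t∧x∧u≤y** t∧x∧u≤v** ⟩
    y * * ∧ v * *    ≤⟨ **-∧ y v ⟩
    (y ∧ v) * *      ∎)
    where
    t : Carrier
    t = (x ⇒ y) ∧ (u ⇒ v)
    t∧x∧u≤y** : t ∧ (x ∧ u) ≤ y * *
    t∧x∧u≤y** = ⇒-elim (≤-trans (x∧y≤y t (x ∧ u)) (≤-trans (x∧y≤x x u) (x≤x** x)))
                       (≤-trans (x∧y≤x t (x ∧ u)) (x∧y≤x (x ⇒ y) (u ⇒ v)))
    t∧x∧u≤v** : t ∧ (x ∧ u) ≤ v * *
    t∧x∧u≤v** = ⇒-elim (≤-trans (x∧y≤y t (x ∧ u)) (≤-trans (x∧y≤y x u) (x≤x** u)))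
                       (≤-trans (x∧y≤x t (x ∧ u)) (x∧y≤y (x ⇒ y) (u ⇒ v)))

  ⇒-* : ∀ x y → y ⇒ x ≤ x * ⇒ y *
  ⇒-* x y = begin
    y * ∨ x * *      ≈⟨ ∨-comm (y *) (x * *) ⟩
    x * * ∨ y *      ≤⟨ ∨-monotonic ≤-refl (x≤x** (y *)) ⟩
    x * ⇒ y *        ∎

module DeductiveSystem₂Properties {c ℓ p : Level} (L : StoneLattice c ℓ) {A : StoneLattice.Carrier L → Set p}
                                  (D : IsDeductiveSystem₂ L A) where
  open StoneLattice L hiding (_≤_)
  open StoneLatticeProperties L
  open IsDeductiveSystem₂ D

  𝟙≤⇒∈ : ∀ {x} → 𝟙 ≤ x → A x
  𝟙≤⇒∈ {x} 𝟙≤x = respects (≤-antisym 𝟙≤x (≤𝟙 x)) has-𝟙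

  ∈-resp-≤ : A Respects _≤_
  ∈-resp-≤ {x} {y} x≤y x∈A = mp x y x∈A (𝟙≤⇒∈ (≤⇒𝟙≤⇒ x≤y))

  ∧-closed : ∀ {x y} → A x → A y → A (x ∧ y)
  ∧-closed {x} {y} x∈A y∈A =
    mp y (x ∧ y) y∈A (∈-resp-≤ (⇒-intro (x≤x** (x ∧ y))) x∈A)

  ∈-∧-≤ : ∀ {x y z} → A x → A y → x ∧ y ≤ z → A z
  ∈-∧-≤ x∈A y∈A x∧y≤z = ∈-resp-≤ x∧y≤z (∧-closed x∈A y∈A)

  Θ-refl : Reflexive (Θ L A)
  Θ-refl {x} = x⇒x∈A , x⇒x∈A
    where
    x⇒x∈A : A (x ⇒ x)
    x⇒x∈A = respects (sym (stone x)) has-𝟙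

  Θ-sym : Symmetric (Θ L A)
  Θ-sym (x⇒y , y⇒x) = y⇒x , x⇒y

  Θ-trans : Transitive (Θ L A)
  Θ-trans {x} {y} {z} (x⇒y , y⇒x) (y⇒z , z⇒y) =
    ∈-∧-≤ x⇒y y⇒z (⇒-trans x y z) , ∈-∧-≤ z⇒y y⇒x (⇒-trans z y x)

  Θ-∨ : ∀ {x y u v} → Θ L A x y → Θ L A u v → Θ L A (x ∨ u) (y ∨ v)
  Θ-∨ {x} {y} {u} {v} (x⇒y , y⇒x) (u⇒v , v⇒u) =
    ∈-∧-≤ x⇒y u⇒v (⇒-∨ x y u v) , ∈-∧-≤ y⇒x v⇒u (⇒-∨ y x v u)

  Θ-∧ : ∀ {x y u v} → Θ L A x y → Θ L A u v → Θ L A (x ∧ u) (y ∧ v)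
  Θ-∧ {x} {y} {u} {v} (x⇒y , y⇒x) (u⇒v , v⇒u) =
    ∈-∧-≤ x⇒y u⇒v (⇒-∧ x y u v) , ∈-∧-≤ y⇒x v⇒u (⇒-∧ y x v u)

  Θ-* : ∀ {x y} → Θ L A x y → Θ L A (x *) (y *)
  Θ-* {x} {y} (x⇒y , y⇒x) = ∈-resp-≤ (⇒-* x y) y⇒x , ∈-resp-≤ (⇒-* y x) x⇒y

  Θ-𝟙-class : ∀ x → Θ L A x 𝟙 ⇔ A (x * *)
  Θ-𝟙-class x = mk⇔ (λ (_ , 𝟙⇒x) → respects (𝟙⇒x≈x** x) 𝟙⇒x)
                    (λ x**∈A → 𝟙≤⇒∈ (≤⇒𝟙≤⇒ (≤𝟙 x)) , respects (sym (𝟙⇒x≈x** x)) x**∈A)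

  Θ-isCompatible : IsCompatible L (Θ L A)
  Θ-isCompatible = record
    { ∨-compat = Θ-∨ ; ∧-compat = Θ-∧ ; *-compat = Θ-* ; 𝟘-compat = Θ-refl ; 𝟙-compat = Θ-refl }

  Θ-isCongruence : IsCongruence L (Θ L A)
  Θ-isCongruence = record
    { refl′ = Θ-refl ; sym′ = Θ-sym ; trans′ = Θ-trans ; ∨-compat = Θ-∨ ; ∧-compat = Θ-∧ ; *-compat = Θ-* }

theorem5p8 : {c ℓ p : Level} (L : StoneLattice c ℓ) (A : StoneLattice.Carrier L → Set p)
    → IsDeductiveSystem₂ L A
    → (Reflexive (Θ L A) × Symmetric (Θ L A) × IsCompatible L (Θ L A)
    × (∀ x → Θ L A x (StoneLattice.𝟙 L) ⇔ A (StoneLattice._* L (StoneLattice._* L x))))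
    × ((∀ x y → A x → A y → A (StoneLattice._∧_ L x y)) → IsCongruence L (Θ L A))
theorem5p8 L A D = (Θ-refl , Θ-sym , Θ-isCompatible , Θ-𝟙-class) , λ _ → Θ-isCongruence
  where open DeductiveSystem₂Properties L D
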